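{- Let $\mathcal{T}$ be a closed PDL-tableau. Then for every node $t$ of $\mathcal{T}$, the sequent $\Lambda(t)$ labelling $t$ is unsatisfiable (where marks on loaded programs are ignored semantically).
   Context: PDL syntax: $\phi ::= \bot \mid p \mid \lnot\phi \mid \phi\land\phi \mid [\alpha]\phi$, $\alpha ::= a \mid \tau? \mid \alpha\cup\beta \mid \alpha;\beta \mid \alpha^\ast$ ($a$ atomic programs), with standard Kripke semantics. For a list $\bar\delta=\delta_1\cdots\delta_n$ of programs, $\Box(\bar\delta,\phi)=[\delta_1]\cdots[\delta_n]\phi$ ($=\phi$ if $\bar\delta=\varepsilon$); juxtaposition is concatenation. Unfolding boxes: $\mathit{Tests}(a)=\emptyset$, $\mathit{Tests}(\tau?)=\{\tau\}$, $\mathit{Tests}(\alpha\cup\beta)=\mathit{Tests}(\alpha;\beta)=\mathit{Tests}(\alpha)\cup\mathit{Tests}(\beta)$, $\mathit{Tests}(\alpha^\ast)=\mathit{Tests}(\alpha)$. For a set $\ell$ of formulas: $P^\ell(a)=\{a\}$; $P^\ell(\tau?)=\{\varepsilon\}$ if $\tau\in\ell$, else $\emptyset$; $P^\ell(\beta\cup\gamma)=P^\ell(\beta)\cup P^\ell(\gamma)$; $P^\ell(\beta;\gamma)=\{\bar\beta\gamma\mid\bar\beta\in P^\ell(\beta)\setminus\{\varepsilon\}\}\cup\{\bar\gamma\mid\bar\gamma\in P^\ell(\gamma),\varepsilon\in P^\ell(\beta)\}$; $P^\ell(\beta^\ast)=\{\varepsilon\}\cup\{\bar\beta\beta^\ast\mid\bar\beta\in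 P^\ell(\beta)\setminus\{\varepsilon\}\}$. $F^\ell(\alpha)=\{\lnot\tau\mid\tau\in\mathit{Tests}(\alpha),\tau\notin\ell\}$, $X^\ell_{\alpha,\psi}=F^\ell(\alpha)\cup\{\Box(\bar\alpha,\psi)\mid\bar\alpha\in P^\ell(\alpha)\}$, $\mathsf{unfold}_\Box(\alpha,\psi)=\{X^\ell_{\alpha,\psi}\mid\ell\subseteq\mathit{Tests}(\alpha)\}$. Unfolding diamonds: $H_a=\{(\emptyset,a)\}$, $H_{\tau?}=\{(\{\tau\},\varepsilon)\}$, $H_{\alpha\cup\beta}=H_\alpha\cup H_\beta$, $H_{\alpha;\beta}=\{(X,\bar\delta\beta)\mid(X,\bar\delta)\in H_\alpha,\bar\delta\neq\varepsilon\}\cup\{(X\cup Y,\bar\delta)\mid(X,\varepsilon)\in H_\alpha,(Y,\bar\delta)\in H_\beta\}$, $H_{\alpha^\ast}=\{(\emptyset,\varepsilon)\}\cup\{(X,\bar\delta\alpha^\ast)\mid(X,\bar\delta)\in H_\alpha,\bar\delta\neq\varepsilon\}$; $\mathsf{unfold}_\Diamond(\alpha,\psi)=\{X\cup\{\lnot\Box(\bar\delta,\psi)\}\mid(X,\bar\delta)\in H_\alpha\}$. Loading: each program $\alpha$ has a marked copy $\underline\alpha$ (semantically identical). A loaded formula has the form $\lnot[\underline{\alpha_1}]\cdots[\underline{\alpha_n}]\phi$, $n\ge1$, $\phi$ an unmarked PDL formula; $\xi$ ranges over PDL formulas and expressions $[\underline{\alpha_1}]\cdots[\underline{\alpha_k}]\phi$,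 $k\ge1$. $\underline\Box(\bar\delta,\xi)=[\underline{\delta_1}]\cdots[\underline{\delta_n}]\xi$, $\underline{\mathsf{unfold}}_\Diamond(\alpha,\xi)=\{X\cup\{\lnot\underline\Box(\bar\delta,\xi)\}\mid(X,\bar\delta)\in H_\alpha\}$. A sequent (finite set of possibly loaded formulas) is loaded if it contains a loaded formula, else free; it is basic if all its formulas have the form $\bot,\lnot\bot,p,\lnot p,[a]\phi,\lnot[a]\phi$ ($a$ atomic). $\Delta_a=\{\phi\mid[a]\phi\in\Delta\}$. Rules (principal formula not in context $\Delta$): $(\lnot)$ $\Delta,\lnot\lnot\phi/\Delta,\phi$; $(\land)$ $\Delta,\phi\land\psi/\Delta,\phi,\psi$; $(\lnot\land)$ $\Delta,\lnot(\phi\land\psi)/\Delta,\lnot\phi\mid\Delta,\lnot\psi$; $(\Box)$ $\Delta,[\alpha]\phi/\{\Delta\cup\Gamma\mid\Gamma\in\mathsf{unfold}_\Box(\alpha,\phi)\}$, $\alpha$ non-atomic; $(\Diamond)$ $\Delta,\lnot[\alpha]\phi/\{\Delta\cup\Gamma\mid\Gamma\in\mathsf{unfold}_\Diamond(\alpha,\phi)\}$, $\alpha$ non-atomic; $(\underline\Diamond)$ $\Delta,\lnot[\underline\alpha]\xi/\{\Delta\cup\Gamma\mid\Gamma\in\underline{\mathsf{unfold}}_\Diamond(\alpha,\xi)\}$, $\alpha$ non-atomic; $(L+)$ $\Delta,\lnot[a][\alpha_1]\cdots[\alpha_n]\phi/\Delta,\lnot[\underline a][\underline{\alpha_1}]\cdots[\underline{\alpha_n}]\phi$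 with $\Delta$ free and basic, $n\ge0$ maximal; $(L-)$ $\Delta,\lnot[\underline{\alpha_1}]\cdots[\underline{\alpha_n}]\phi/\Delta,\lnot[\alpha_1]\cdots[\alpha_n]\phi$ with $\Delta$ basic, $n\ge1$; modal rule $(M)$ $\Delta,\lnot[\underline a]\xi/\Delta_a,\lnot\xi$ with $\Delta$ basic. $(L-)$ may not be applied to a node produced by $(L+)$. A tableau is a rooted tree labelled by sequents in which each interior node with its children is a rule instance. A repeat is a node whose label equals that of a proper ancestor (nearest such: its companion); it is a loaded-path repeat if all nodes from companion to it are loaded, a free repeat if it is free. A PDL-tableau is a tableau in which all loaded-path repeats and all free repeats are leaves. A node is closed if its label contains $\bot$ or some $\phi$ and $\lnot\phi$; a PDL-tableau is closed if every leaf is closed or a loaded-path repeat. -}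

module Defs where

open import Level using (0ℓ)
open import Data.Nat using (ℕ)
open import Data.Bool using (Bool; true; false)
open import Data.List using (List; []; _∷_; _++_)
open import Data.List.Membership.Propositional using (_∈_; _∉_)
open import Data.List.Relation.Unary.Any using (Any)
open import Data.Product using (Σ; ∃; _×_; _,_; proj₁)
open import Data.Sum using (_⊎_)
open import Data.Empty using (⊥)
open import Relation.Nullary using (¬_)
open import Relation.Binary.PropositionalEquality using (_≡_; _≢_)
open import Relation.Binary.Construct.Closure.ReflexiveTransitive using (Star)

infixr 6 _⊕_
infixr 7 _⨾_
infix  8 _⋆

mutual
  data Form : Set where
    ⊥'   : Form
    var  : ℕ → Form
    ~_   : Form → Form
    _&_  : Form → Form → Form
    [_]_ : Prog → Form → Form

  data Prog : Set where
    atom : ℕ → Prog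
    test : Form → Prog
    _⊕_  : Prog → Prog → Prog
    _⨾_  : Prog → Prog → Prog
    _⋆   : Prog → Prog

Box : List Prog → Form → Form
Box []       φ = φ
Box (δ ∷ δs) φ = [ δ ] Box δs φ

NonAtomic : Prog → Set
NonAtomic α = ¬ (∃ λ a → α ≡ atom a)

NotBox : Form → Set
NotBox φ = ∀ β ψ → φ ≢ ([ β ] ψ)

record Model : Set₁ where
  field
    W : Set
    R : ℕ → W → W → Set
    V : ℕ → W → Set

module Semantics (M : Model) where
  open Model M
  mutual
    _⊨_ : W → Form → Set
    w ⊨ ⊥'        = ⊥
    w ⊨ var p     = V p w
    w ⊨ (~ φ)     = ¬ (w ⊨ φ)
    w ⊨ (φ & ψ)   = (w ⊨ φ) × (w ⊨ ψ)
    w ⊨ ([ α ] φ) = ∀ v → Rel α w v → v ⊨ φ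

    Rel : Prog → W → W → Set
    Rel (atom a) w v = R a w v
    Rel (test τ) w v = (w ≡ v) × (w ⊨ τ)
    Rel (α ⊕ β)  w v = Rel α w v ⊎ Rel β w v
    Rel (α ⨾ β)  w v = ∃ λ u → Rel α w u × Rel β u v
    Rel (α ⋆)        = Star (Rel α)

-- Sequent formulas: unmarked PDL formulas and loaded formulas.
-- ld α αs φ  represents the loaded formula  ¬[α̲][α̲₁]⋯[α̲ₖ]φ
-- (αs = α₁⋯αₖ, φ an unmarked PDL formula).  The expression ξ after the
-- first marked box is thus represented by the pair (αs , φ): if αs = []
-- then ξ = φ, otherwise ξ = [α̲₁]⋯[α̲ₖ]φ.

data SF : Set where
  fm : Form → SF
  ld : Prog → List Prog → Form → SF

negLBox : List Prog → Form → SF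
negLBox []       φ = fm (~ φ)
negLBox (δ ∷ δs) φ = ld δ δs φ

-- Sequents: finite sets of formulas, represented as lists read as sets.
Seq : Set
Seq = List SF

_≈_ : Seq → Seq → Set
Γ ≈ Δ = ∀ x → ((x ∈ Γ → x ∈ Δ) × (x ∈ Δ → x ∈ Γ))

_≈P_ : Seq → (SF → Set) → Set
Γ ≈P P = ∀ x → ((x ∈ Γ → P x) × (P x → x ∈ Γ))

data IsLoaded : SF → Set where
  isLd : ∀ {α αs φ} → IsLoaded (ld α αs φ)

Loaded : Seq → Set
Loaded Γ = Any IsLoaded Γ

Free : Seq → Set
Free Γ = ¬ Loaded Γ

-- basic formulas (marks ignored: ¬[a̲]ξ counts as a formula ¬[a]…)
data IsBasic : SF → Set where
  b⊥    : IsBasic (fm ⊥')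
  b¬⊥   : IsBasic (fm (~ ⊥'))
  bp    : ∀ {p} → IsBasic (fm (var p))
  b¬p   : ∀ {p} → IsBasic (fm (~ var p))
  b□    : ∀ {a φ} → IsBasic (fm ([ atom a ] φ))
  b◇    : ∀ {a φ} → IsBasic (fm (~ ([ atom a ] φ)))
  b◇ld  : ∀ {a αs φ} → IsBasic (ld (atom a) αs φ)

Basic : Seq → Set
Basic Γ = ∀ x → x ∈ Γ → IsBasic x

Tests : Prog → List Form
Tests (atom a) = []
Tests (test τ) = τ ∷ []
Tests (α ⊕ β)  = Tests α ++ Tests β
Tests (α ⨾ β)  = Tests α ++ Tests β
Tests (α ⋆)    = Tests α

data P (ℓ : List Form) : Prog → List Prog → Set where
  p-atom : ∀ {a} → P ℓ (atom a) (atom a ∷ [])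
  p-test : ∀ {τ} → τ ∈ ℓ → P ℓ (test τ) []
  p-∪l   : ∀ {β γ δs} → P ℓ β δs → P ℓ (β ⊕ γ) δs
  p-∪r   : ∀ {β γ δs} → P ℓ γ δs → P ℓ (β ⊕ γ) δs
  p-seq1   : ∀ {β γ δ δs} → P ℓ β (δ ∷ δs) → P ℓ (β ⨾ γ) ((δ ∷ δs) ++ (γ ∷ []))
  p-seq2   : ∀ {β γ δs} → P ℓ β [] → P ℓ γ δs → P ℓ (β ⨾ γ) δs
  p-*0   : ∀ {β} → P ℓ (β ⋆) []
  p-*1   : ∀ {β δ δs} → P ℓ β (δ ∷ δs) → P ℓ (β ⋆) ((δ ∷ δs) ++ (β ⋆ ∷ []))

X□ : List Form → Prog → Form → SF → Set
X□ ℓ α ψ x =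
    (∃ λ τ → (τ ∈ Tests α) × (τ ∉ ℓ) × (x ≡ fm (~ τ)))
  ⊎ (∃ λ δs → P ℓ α δs × (x ≡ fm (Box δs ψ)))

BoxIdx : Prog → Set
BoxIdx α = Σ (List Form) (λ ℓ → ∀ τ → τ ∈ ℓ → τ ∈ Tests α)

data H : Prog → List Form → List Prog → Set where
  h-atom : ∀ {a} → H (atom a) [] (atom a ∷ [])
  h-test : ∀ {τ} → H (test τ) (τ ∷ []) []
  h-∪l   : ∀ {α β X δs} → H α X δs → H (α ⊕ β) X δs
  h-∪r   : ∀ {α β X δs} → H β X δs → H (α ⊕ β) X δs
  h-seq1   : ∀ {α β X δ δs} → H α X (δ ∷ δs) → H (α ⨾ β) X ((δ ∷ δs) ++ (β ∷ []))
  h-seq2   : ∀ {α β X Y δs} → H α X [] → H β Y δs → H (α ⨾ β) (X ++ Y) δs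
  h-*0   : ∀ {α} → H (α ⋆) [] []
  h-*1   : ∀ {α X δ δs} → H α X (δ ∷ δs) → H (α ⋆) X ((δ ∷ δs) ++ (α ⋆ ∷ []))

DiaIdx : Prog → Set
DiaIdx α = Σ (List Form) (λ X → Σ (List Prog) (λ δs → H α X δs))

X◇ : (α : Prog) → Form → DiaIdx α → SF → Set
X◇ α ψ (X , δs , _) x = (∃ λ τ → (τ ∈ X) × (x ≡ fm τ)) ⊎ (x ≡ fm (~ Box δs ψ))

X◇L : (α : Prog) → List Prog → Form → DiaIdx α → SF → Set
X◇L α αs φ (X , δs , _) x = (∃ λ τ → (τ ∈ X) × (x ≡ fm τ)) ⊎ (x ≡ negLBox (δs ++ αs) φ)

Princ : Seq → Seq → SF → Set
Princ Γ Δ x = (Γ ≈ (x ∷ Δ)) × (x ∉ Δ)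

ChildrenOf : Seq → (I : Set) → (I → SF → Set) → List Seq → Set
ChildrenOf Δ I S cs =
    (∀ c → c ∈ cs → ∃ λ i → c ≈P (λ x → (x ∈ Δ) ⊎ S i x))
  × (∀ i → ∃ λ c → (c ∈ cs) × (c ≈P (λ x → (x ∈ Δ) ⊎ S i x)))

MChild : Seq → ℕ → List Prog → Form → SF → Set
MChild Δ a αs φ x = (∃ λ ψ → (fm ([ atom a ] ψ) ∈ Δ) × (x ≡ fm ψ)) ⊎ (x ≡ negLBox αs φ)

data Step (Γ : Seq) : List Seq → Set where
  r¬  : ∀ {Δ φ c} → Princ Γ Δ (fm (~ (~ φ))) → c ≈ (fm φ ∷ Δ) → Step Γ (c ∷ [])
  r∧  : ∀ {Δ φ ψ c} → Princ Γ Δ (fm (φ & ψ)) → c ≈ (fm φ ∷ fm ψ ∷ Δ) → Step Γ (c ∷ [])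
  r¬∧ : ∀ {Δ φ ψ c d} → Princ Γ Δ (fm (~ (φ & ψ))) →
        c ≈ (fm (~ φ) ∷ Δ) → d ≈ (fm (~ ψ) ∷ Δ) → Step Γ (c ∷ d ∷ [])
  r□  : ∀ {Δ α φ cs} → NonAtomic α → Princ Γ Δ (fm ([ α ] φ)) →
        ChildrenOf Δ (BoxIdx α) (λ i x → X□ (proj₁ i) α φ x) cs → Step Γ cs
  r◇  : ∀ {Δ α φ cs} → NonAtomic α → Princ Γ Δ (fm (~ ([ α ] φ))) →
        ChildrenOf Δ (DiaIdx α) (X◇ α φ) cs → Step Γ cs
  r◇L : ∀ {Δ α αs φ cs} → NonAtomic α → Princ Γ Δ (ld α αs φ) →
        ChildrenOf Δ (DiaIdx α) (X◇L α αs φ) cs → Step Γ cs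
  rL+ : ∀ {Δ a αs φ c} → Free Δ → Basic Δ → NotBox φ →
        Princ Γ Δ (fm (~ Box (atom a ∷ αs) φ)) → c ≈ (ld (atom a) αs φ ∷ Δ) → Step Γ (c ∷ [])
  rL- : ∀ {Δ α αs φ c} → Basic Δ →
        Princ Γ Δ (ld α αs φ) → c ≈ (fm (~ Box (α ∷ αs) φ) ∷ Δ) → Step Γ (c ∷ [])
  rM  : ∀ {Δ a αs φ c} → Basic Δ →
        Princ Γ Δ (ld (atom a) αs φ) → c ≈P MChild Δ a αs φ → Step Γ (c ∷ [])

isL+ : ∀ {Γ cs} → Step Γ cs → Bool
isL+ (rL+ _ _ _ _ _) = true
isL+ _               = false

isL- : ∀ {Γ cs} → Step Γ cs → Bool
isL- (rL- _ _ _) = true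
isL- _           = false

mutual
  data Tab : Seq → Set where
    leaf : (Γ : Seq) → Tab Γ
    node : ∀ {Γ cs} → Step Γ cs → Tabs cs → Tab Γ

  data Tabs : List Seq → Set where
    []  : Tabs []
    _∷_ : ∀ {Γ cs} → Tab Γ → Tabs cs → Tabs (Γ ∷ cs)

mutual
  data NodeOf : ∀ {Γ} → Tab Γ → Seq → Set where
    here  : ∀ {Γ} {t : Tab Γ} → NodeOf t Γ
    below : ∀ {Γ cs Δ} {r : Step Γ cs} {ts : Tabs cs} → NodesOf ts Δ → NodeOf (node r ts) Δ

  data NodesOf : ∀ {cs} → Tabs cs → Seq → Set where
    hd : ∀ {Γ cs Δ} {t : Tab Γ} {ts : Tabs cs} → NodeOf t Δ → NodesOf (t ∷ ts) Δ
    tl : ∀ {Γ cs Δ} {t : Tab Γ} {ts : Tabs cs} → NodesOf ts Δ → NodesOf (t ∷ ts) Δ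

-- Repeats.  Histories list the labels of the proper ancestors, nearest first.

Repeat : List Seq → Seq → Set
Repeat hist Γ = Any (λ Γ' → Γ' ≈ Γ) hist

data LoadedToCompanion (Γ : Seq) : List Seq → Set where
  here  : ∀ {Γ' hist} → Γ' ≈ Γ → Loaded Γ' → LoadedToCompanion Γ (Γ' ∷ hist)
  there : ∀ {Γ' hist} → ¬ (Γ' ≈ Γ) → Loaded Γ' →
          LoadedToCompanion Γ hist → LoadedToCompanion Γ (Γ' ∷ hist)

LoadedPathRepeat : List Seq → Seq → Set
LoadedPathRepeat hist Γ = Loaded Γ × LoadedToCompanion Γ hist

FreeRepeat : List Seq → Seq → Set
FreeRepeat hist Γ = Free Γ × Repeat hist Γ

-- PDL-tableaux.  The Bool records whether the node was produced by (L+).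

mutual
  data PDLOK (hist : List Seq) (byL+ : Bool) : ∀ {Γ} → Tab Γ → Set where
    leafOK : ∀ Γ → PDLOK hist byL+ (leaf Γ)
    nodeOK : ∀ {Γ cs} {r : Step Γ cs} {ts : Tabs cs} →
             ¬ LoadedPathRepeat hist Γ → ¬ FreeRepeat hist Γ →
             (byL+ ≡ true → isL- r ≡ false) →
             PDLOKs (Γ ∷ hist) (isL+ r) ts → PDLOK hist byL+ (node r ts)

  data PDLOKs (hist : List Seq) (byL+ : Bool) : ∀ {cs} → Tabs cs → Set where
    []  : PDLOKs hist byL+ []
    _∷_ : ∀ {Γ cs} {t : Tab Γ} {ts : Tabs cs} →
          PDLOK hist byL+ t → PDLOKs hist byL+ ts → PDLOKs hist byL+ (t ∷ ts)

IsPDLTableau : ∀ {Γ} → Tab Γ → Set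
IsPDLTableau t = PDLOK [] false t

ClosedSeq : Seq → Set
ClosedSeq Γ = (fm ⊥' ∈ Γ) ⊎ (∃ λ φ → (fm φ ∈ Γ) × (fm (~ φ) ∈ Γ))

mutual
  data LeavesClosed (hist : List Seq) : ∀ {Γ} → Tab Γ → Set where
    leafC : ∀ Γ → ClosedSeq Γ ⊎ LoadedPathRepeat hist Γ → LeavesClosed hist (leaf Γ)
    nodeC : ∀ {Γ cs} {r : Step Γ cs} {ts : Tabs cs} →
            LeavesClosedS (Γ ∷ hist) ts → LeavesClosed hist (node r ts)

  data LeavesClosedS (hist : List Seq) : ∀ {cs} → Tabs cs → Set where
    []  : LeavesClosedS hist []
    _∷_ : ∀ {Γ cs} {t : Tab Γ} {ts : Tabs cs} →
          LeavesClosed hist t → LeavesClosedS hist ts → LeavesClosedS hist (t ∷ ts)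

IsClosedPDLTableau : ∀ {Γ} → Tab Γ → Set
IsClosedPDLTableau t = IsPDLTableau t × LeavesClosed [] t

module _ (M : Model) where
  open Model M
  open Semantics M

  evalSF : W → SF → Set
  evalSF w (fm φ)      = w ⊨ φ
  evalSF w (ld α αs φ) = ¬ (w ⊨ Box (α ∷ αs) φ)

Satisfiable : Seq → Set₁
Satisfiable Γ = Σ Model (λ M → ∃ λ (w : Model.W M) → ∀ x → x ∈ Γ → evalSF M w x)

-- Suppose a node of a closed tableau were satisfiable.  Every rule has a premise that is
-- satisfied as well, so following satisfied nodes downwards ends in a loaded-path repeat.
-- A loaded formula ¬[α̲]⋯φ is satisfied together with a witness run of its diamond, and we
-- bound the number of atomic steps of these runs.  Along a loaded path the unfolding rule
-- for loaded diamonds never lengthens the witnesses and (M) shortens them, while every other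
-- rule replaces a formula by lighter ones, so it cannot return to the same sequent on its own.
-- Hence on returning to the companion the bound has strictly decreased, and well-founded
-- induction on the bound rules the repeat out; (L+) resets the bound, but only at free nodes,
-- which never lie on a loaded path.
module Submission where

open import Defs
open import Level using (0ℓ)
open import Axiom.ExcludedMiddle using (ExcludedMiddle)
open import Axiom.DoubleNegationElimination using (em⇒dne)
open import Data.Nat using (ℕ; suc; _+_; _⊔_; _≤_; _<_; _≤?_; z≤n; s≤s)
open import Data.Nat.Properties
open import Data.Nat.Induction using (<-rec)
open import Data.List using (List; []; _∷_; _++_; filter)
open import Data.List.Membership.Propositional using (_∈_; _∉_)
open import Data.List.Membership.Propositional.Properties using (∈-++⁻; ∈-++⁺ˡ; ∈-++⁺ʳ; ∈-filter⁺; ∈-filter⁻)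
open import Data.List.Relation.Binary.Subset.Propositional using (_⊆_)
open import Data.List.Relation.Binary.Subset.Propositional.Properties using (Any-resp-⊆)
open import Data.List.Relation.Unary.Any using (here; there)
open import Data.Product using (∃; ∃₂; _×_; _,_; proj₁; proj₂)
open import Data.Sum using (_⊎_; inj₁; inj₂; swap) renaming ([_,_]′ to either)
import Data.Sum as ⊎
open import Data.Empty using (⊥; ⊥-elim)
open import Function using (_∘_)
open import Relation.Nullary using (¬_; yes; no)
open import Relation.Unary using (Decidable)
open import Relation.Binary.PropositionalEquality using (refl; sym; subst)
open import Relation.Binary.Construct.Closure.ReflexiveTransitive using (Star; ε; _◅_)

private
  variable
    a : ℕ
    k m n : ℕ
    α β : Prog
    αs δs : List Prog
    τ : Form
    φ : Form

-- Boxes with an atomic head weigh nothing: the local rules never decompose them, and the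
-- unfoldings of [α]φ consist of such boxes, of φ itself and of the (negated) tests of α.
mutual
  weight : Form → ℕ
  weight ⊥'        = 0
  weight (var _)   = 0
  weight (~ φ)     = suc (weight φ)
  weight (φ & ψ)   = suc (weight φ + weight ψ)
  weight ([ α ] φ) = boxWeight α (weight φ)

  boxWeight : Prog → ℕ → ℕ
  boxWeight (atom _) k = 0
  boxWeight α        k = suc (k + testWeight α)

  testWeight : Prog → ℕ
  testWeight (atom _) = 0
  testWeight (test τ) = suc (weight τ)
  testWeight (α ⊕ β)  = testWeight α + testWeight β
  testWeight (α ⨾ β)  = testWeight α + testWeight β
  testWeight (α ⋆)    = testWeight α

sfWeight : SF → ℕ
sfWeight (fm φ)      = weight φ
sfWeight (ld α αs φ) = suc (weight (~ Box (α ∷ αs) φ))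

<-boxWeight : NonAtomic α → m ≤ k + testWeight α → m < boxWeight α k
<-boxWeight {atom a} na _ = ⊥-elim (na (a , refl))
<-boxWeight {test _} _  m≤ = s≤s m≤
<-boxWeight {_ ⊕ _}  _  m≤ = s≤s m≤
<-boxWeight {_ ⨾ _}  _  m≤ = s≤s m≤
<-boxWeight {_ ⋆}    _  m≤ = s≤s m≤

mutual
  weight<testWeight : ∀ α → τ ∈ Tests α → weight τ < testWeight α
  weight<testWeight (test _) (here refl) = ≤-refl
  weight<testWeight (α ⊕ β)  τ∈ = weight<testWeight-++ α β τ∈
  weight<testWeight (α ⨾ β)  τ∈ = weight<testWeight-++ α β τ∈
  weight<testWeight (α ⋆)    τ∈ = weight<testWeight α τ∈

  weight<testWeight-++ : ∀ α β → τ ∈ Tests α ++ Tests β → weight τ < testWeight α + testWeight β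
  weight<testWeight-++ α β τ∈ =
    either (λ τ∈α → ≤-trans (weight<testWeight α τ∈α) (m≤m+n _ _))
           (λ τ∈β → ≤-trans (weight<testWeight β τ∈β) (m≤n+m _ _))
           (∈-++⁻ (Tests α) τ∈)

data AtomHeaded : List Prog → Set where
  []   : AtomHeaded []
  atom : ∀ a δs → AtomHeaded (atom a ∷ δs)

weight-Box-atomHeaded : AtomHeaded δs → weight (Box δs φ) ≤ weight φ
weight-Box-atomHeaded []         = ≤-refl
weight-Box-atomHeaded (atom _ _) = z≤n

P-atomHeaded : ∀ {ℓ} → P ℓ α δs → AtomHeaded δs
P-atomHeaded p-atom       = atom _ _
P-atomHeaded (p-test _)   = []
P-atomHeaded (p-∪l p)     = P-atomHeaded p
P-atomHeaded (p-∪r p)     = P-atomHeaded p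
P-atomHeaded (p-seq1 p) with P-atomHeaded p
... | atom _ _ = atom _ _
P-atomHeaded (p-seq2 _ p) = P-atomHeaded p
P-atomHeaded p-*0         = []
P-atomHeaded (p-*1 p) with P-atomHeaded p
... | atom _ _ = atom _ _

H-atomHeaded : ∀ {X} → H α X δs → AtomHeaded δs
H-atomHeaded h-atom       = atom _ _
H-atomHeaded h-test       = []
H-atomHeaded (h-∪l h)     = H-atomHeaded h
H-atomHeaded (h-∪r h)     = H-atomHeaded h
H-atomHeaded (h-seq1 h) with H-atomHeaded h
... | atom _ _ = atom _ _
H-atomHeaded (h-seq2 _ h) = H-atomHeaded h
H-atomHeaded h-*0         = []
H-atomHeaded (h-*1 h) with H-atomHeaded h
... | atom _ _ = atom _ _

H-tests : ∀ {X} → H α X δs → X ⊆ Tests α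
H-tests h-test              τ∈ = τ∈
H-tests (h-∪l h)            τ∈ = ∈-++⁺ˡ (H-tests h τ∈)
H-tests (h-∪r {α} h)        τ∈ = ∈-++⁺ʳ (Tests α) (H-tests h τ∈)
H-tests (h-seq1 h)          τ∈ = ∈-++⁺ˡ (H-tests h τ∈)
H-tests (h-seq2 {α} {X = X} h₁ h₂) τ∈ =
  either (∈-++⁺ˡ ∘ H-tests h₁) (∈-++⁺ʳ (Tests α) ∘ H-tests h₂) (∈-++⁻ X τ∈)
H-tests (h-*1 h)            τ∈ = H-tests h τ∈

weight-Box-++-atomHeaded : AtomHeaded δs → weight (Box (δs ++ αs) φ) ≤ weight (Box αs φ)
weight-Box-++-atomHeaded []         = ≤-refl
weight-Box-++-atomHeaded (atom _ _) = z≤n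

sfWeight-negLBox : ∀ δs → sfWeight (negLBox δs φ) ≤ suc (suc (weight (Box δs φ)))
sfWeight-negLBox []      = n≤1+n _
sfWeight-negLBox (_ ∷ _) = ≤-refl

-- Replacement steps cannot return to a superset of their starting point: the heaviest
-- dropped element could only be re-added by dropping an even heavier one.
module Replacement {A : Set} (weight : A → ℕ) where

  record Replaces (Γ Δ : List A) : Set where
    field
      dropped  : A
      dropped∈ : dropped ∈ Γ
      dropped∉ : dropped ∉ Δ
      lighter  : ∀ {z} → z ∈ Δ → z ∈ Γ ⊎ weight z < weight dropped
  open Replaces

  maxDropped : ∀ {Γ Δ} → Star Replaces Γ Δ → ℕ
  maxDropped ε       = 0
  maxDropped (s ◅ p) = weight (dropped s) ⊔ maxDropped p

  heavy-∉-preserved : ∀ {Γ Δ z} (p : Star Replaces Γ Δ) → maxDropped p ≤ weight z → z ∉ Γ → z ∉ Δ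
  heavy-∉-preserved ε _ z∉ = z∉
  heavy-∉-preserved (s ◅ p) max≤ z∉Γ = heavy-∉-preserved p (≤-trans (m≤n⊔m _ _) max≤) z∉Γ₁
    where
      z∉Γ₁ : _ ∉ _
      z∉Γ₁ z∈Γ₁ with lighter s z∈Γ₁
      ... | inj₁ z∈Γ = z∉Γ z∈Γ
      ... | inj₂ z<x = <⇒≱ z<x (≤-trans (m≤m⊔n _ _) max≤)

  HeavyKept : ℕ → List A → List A → Set
  HeavyKept m Γ Δ = ∀ {z} → m ≤ weight z → z ∈ Γ → z ∈ Δ

  dropped<bound : ∀ {m Γ Γ₁ Δ} (s : Replaces Γ Γ₁) (p : Star Replaces Γ₁ Δ) →
                  maxDropped p ≤ m → HeavyKept m Γ Δ → weight (dropped s) < m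
  dropped<bound {m} s p max≤ kept with m ≤? weight (dropped s)
  ... | yes m≤x =
    ⊥-elim (heavy-∉-preserved p (≤-trans max≤ m≤x) (dropped∉ s) (kept m≤x (dropped∈ s)))
  ... | no  m≰x = ≰⇒> m≰x

  HeavyKept-step : ∀ {m Γ Γ₁ Δ} (s : Replaces Γ Γ₁) → weight (dropped s) < m →
                   HeavyKept m Γ Δ → HeavyKept m Γ₁ Δ
  HeavyKept-step s x<m kept m≤z z∈Γ₁ with lighter s z∈Γ₁
  ... | inj₁ z∈Γ = kept m≤z z∈Γ
  ... | inj₂ z<x = ⊥-elim (<⇒≱ (<-trans z<x x<m) m≤z)

  maxDropped< : ∀ {m Γ Γ₁ Δ} (s : Replaces Γ Γ₁) (p : Star Replaces Γ₁ Δ) →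
                maxDropped (s ◅ p) ≤ m → HeavyKept m Γ Δ → maxDropped (s ◅ p) < m
  maxDropped< {m} s ε max≤ kept = ⊔-lub x<m (≤-<-trans z≤n x<m)
    where
      x<m : weight (dropped s) < m
      x<m = dropped<bound s ε z≤n kept
  maxDropped< {m} s (s₁ ◅ p) max≤ kept =
    ⊔-lub x<m (maxDropped< s₁ p p≤m (HeavyKept-step s x<m kept))
    where
      p≤m : maxDropped (s₁ ◅ p) ≤ m
      p≤m = ≤-trans (m≤n⊔m (weight (dropped s)) _) max≤
      x<m : weight (dropped s) < m
      x<m = dropped<bound s (s₁ ◅ p) p≤m kept

  no-cycle : ∀ {Γ Γ₁ Δ} → Replaces Γ Γ₁ → Star Replaces Γ₁ Δ → ¬ (Γ ⊆ Δ)
  no-cycle s p Γ⊆Δ = <-irrefl refl (maxDropped< s p ≤-refl (λ _ → Γ⊆Δ))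

open Replacement sfWeight using (Replaces; no-cycle)

_⊆_∪_ : Seq → Seq → (SF → Set) → Set
c ⊆ Δ ∪ S = ∀ {z} → z ∈ c → z ∈ Δ ⊎ S z

≈-++⇒⊆∪ : ∀ new {c Δ} → c ≈ (new ++ Δ) → c ⊆ Δ ∪ (_∈ new)
≈-++⇒⊆∪ new c≈ z∈ = swap (∈-++⁻ new (proj₁ (c≈ _) z∈))

Princ-replaces : ∀ {Γ Δ x c S} → Princ Γ Δ x → c ⊆ Δ ∪ S →
                 (∀ {z} → S z → sfWeight z < sfWeight x) → Replaces Γ c
Princ-replaces {x = x} (Γ≈ , x∉Δ) c⊆ lighter = record
  { dropped  = x
  ; dropped∈ = proj₂ (Γ≈ x) (here refl)
  ; dropped∉ = either x∉Δ (λ Sx → <-irrefl refl (lighter Sx)) ∘ c⊆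
  ; lighter  = ⊎.map (proj₂ (Γ≈ _) ∘ there) lighter ∘ c⊆
  }

Princ-free : ∀ {Γ Δ} → Princ Γ Δ (fm φ) → Free Δ → Free Γ
Princ-free (Γ≈ , _) free loaded with Any-resp-⊆ (proj₁ (Γ≈ _)) loaded
... | here ()
... | there loaded′ = free loaded′

-- Descent is the reflexive–transitive closure of Advance, collapsed once the bound has dropped.
data Advance (Γ : Seq) (n : ℕ) (Γ′ : Seq) (n′ : ℕ) : Set where
  shortened : n′ < n → Advance Γ n Γ′ n′
  replaced  : n′ ≤ n → Replaces Γ Γ′ → Advance Γ n Γ′ n′

data Descent (Γ : Seq) (n : ℕ) (Γ′ : Seq) (n′ : ℕ) : Set where
  shortened : n′ < n → Descent Γ n Γ′ n′
  replaced  : n′ ≤ n → Star Replaces Γ Γ′ → Descent Γ n Γ′ n′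

descent-bound : ∀ {Γ Γ′ n′} → Descent Γ n Γ′ n′ → n′ ≤ n
descent-bound (shortened n′<n) = <⇒≤ n′<n
descent-bound (replaced n′≤n _) = n′≤n

advance-descent : ∀ {Γ c Γ′ n₁ n₂} → Advance Γ n c n₁ → Descent c n₁ Γ′ n₂ → Descent Γ n Γ′ n₂
advance-descent (shortened n₁<n) d = shortened (≤-<-trans (descent-bound d) n₁<n)
advance-descent (replaced n₁≤n _) (shortened n₂<n₁) = shortened (<-≤-trans n₂<n₁ n₁≤n)
advance-descent (replaced n₁≤n s) (replaced n₂≤n₁ p) = replaced (≤-trans n₂≤n₁ n₁≤n) (s ◅ p)

advance-return : ∀ {Γ c Γ′ n₁ n₂} → Advance Γ n c n₁ → Descent c n₁ Γ′ n₂ → Γ ⊆ Γ′ → n₂ < n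
advance-return (shortened n₁<n) d _ = ≤-<-trans (descent-bound d) n₁<n
advance-return (replaced n₁≤n _) (shortened n₂<n₁) _ = <-≤-trans n₂<n₁ n₁≤n
advance-return (replaced _ s) (replaced _ p) Γ⊆Γ′ = ⊥-elim (no-cycle s p Γ⊆Γ′)

module CountedRuns (M : Model) where
  open Model M
  open Semantics M

  data Run : Prog → ℕ → W → W → Set where
    atomic  : ∀ {w v} → R a w v → Run (atom a) 1 w v
    tested  : ∀ {w} → w ⊨ τ → Run (test τ) 0 w w
    left    : ∀ {w v} → Run α n w v → Run (α ⊕ β) n w v
    right   : ∀ {w v} → Run β n w v → Run (α ⊕ β) n w v
    seq     : ∀ {w u v} → Run α n w u → Run β m u v → Run (α ⨾ β) (n + m) w v
    stop    : ∀ {w} → Run (α ⋆) 0 w w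
    iterate : ∀ {w u v} → Run α n w u → Run (α ⋆) m u v → Run (α ⋆) (n + m) w v

  data Runs : List Prog → ℕ → W → W → Set where
    []  : ∀ {w} → Runs [] 0 w w
    _∷_ : ∀ {δ w u v} → Run δ n w u → Runs δs m u v → Runs (δ ∷ δs) (n + m) w v

  Run⇒Rel : ∀ {w v} → Run α n w v → Rel α w v
  Run⇒Rel (atomic r)    = r
  Run⇒Rel (tested t)    = refl , t
  Run⇒Rel (left r)      = inj₁ (Run⇒Rel r)
  Run⇒Rel (right r)     = inj₂ (Run⇒Rel r)
  Run⇒Rel (seq r s)     = _ , Run⇒Rel r , Run⇒Rel s
  Run⇒Rel stop          = ε
  Run⇒Rel (iterate r s) = Run⇒Rel r ◅ Run⇒Rel s

  mutual
    Rel⇒Run : ∀ α {w v} → Rel α w v → ∃ λ n → Run α n w v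
    Rel⇒Run (atom a) r            = 1 , atomic r
    Rel⇒Run (test τ) (refl , t)   = 0 , tested t
    Rel⇒Run (α ⊕ β)  (inj₁ r)     = let n , r′ = Rel⇒Run α r in n , left r′
    Rel⇒Run (α ⊕ β)  (inj₂ r)     = let n , r′ = Rel⇒Run β r in n , right r′
    Rel⇒Run (α ⨾ β)  (_ , r , s)  =
      let n , r′ = Rel⇒Run α r ; m , s′ = Rel⇒Run β s in n + m , seq r′ s′
    Rel⇒Run (α ⋆)    rs           = Star⇒Run α rs

    Star⇒Run : ∀ α {w v} → Star (Rel α) w v → ∃ λ n → Run (α ⋆) n w v
    Star⇒Run α ε        = 0 , stop
    Star⇒Run α (r ◅ rs) =
      let n , r′ = Rel⇒Run α r ; m , rs′ = Star⇒Run α rs in n + m , iterate r′ rs′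

  Runs-++⁺ : ∀ {xs ys w u v} → Runs xs n w u → Runs ys m u v → Runs (xs ++ ys) (n + m) w v
  Runs-++⁺ [] rs = rs
  Runs-++⁺ {m = m} {δ ∷ xs} {ys} {w} {v = v} (_∷_ {n = n₁} {m = n₂} r rs) rs′ =
    subst (λ k → Runs (δ ∷ xs ++ ys) k w v) (sym (+-assoc n₁ n₂ m)) (r ∷ Runs-++⁺ rs rs′)

  Runs-++⁻ : ∀ xs {ys w v} → Runs (xs ++ ys) n w v →
             ∃ λ u → (∃ λ k → Runs xs k w u) × (∃ λ k → Runs ys k u v)
  Runs-++⁻ []       rs       = _ , (0 , []) , (_ , rs)
  Runs-++⁻ (x ∷ xs) (r ∷ rs) = let u , (_ , rs₁) , rs₂ = Runs-++⁻ xs rs in u , (_ , r ∷ rs₁) , rs₂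

  Runs-∷ʳ : ∀ {w u v} → Runs δs n w u → Run β m u v → Runs (δs ++ β ∷ []) (n + m) w v
  Runs-∷ʳ {δs} {n} {β} {m} {w} {v = v} rs r =
    subst (λ k → Runs (δs ++ β ∷ []) (n + k) w v) (+-identityʳ m) (Runs-++⁺ rs (r ∷ []))

  Runs-refute : ∀ {w v} → Runs δs n w v → ¬ v ⊨ φ → ¬ w ⊨ Box δs φ
  Runs-refute []       ¬φ φ  = ¬φ φ
  Runs-refute (r ∷ rs) ¬φ □φ = Runs-refute rs ¬φ (□φ _ (Run⇒Rel r))

  Runs⇒Box : ∀ δs {w} → (∀ {v n} → Runs δs n w v → v ⊨ φ) → w ⊨ Box δs φ
  Runs⇒Box []       all = all []
  Runs⇒Box (δ ∷ δs) all u r = Runs⇒Box δs λ rs → all (proj₂ (Rel⇒Run δ r) ∷ rs)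

  P-sound : ∀ {ℓ w v} → P ℓ α δs → (∀ {τ} → τ ∈ ℓ → w ⊨ τ) → Runs δs n w v → Rel α w v
  P-sound p-atom       _ (atomic r ∷ []) = r
  P-sound (p-test τ∈)  ℓ⊨ []          = refl , ℓ⊨ τ∈
  P-sound (p-∪l p)     ℓ⊨ rs          = inj₁ (P-sound p ℓ⊨ rs)
  P-sound (p-∪r p)     ℓ⊨ rs          = inj₂ (P-sound p ℓ⊨ rs)
  P-sound (p-seq1 {δ = δ} {δs} p) ℓ⊨ rs with Runs-++⁻ (δ ∷ δs) rs
  ... | u , (_ , rs₁) , (_ , r ∷ []) = u , P-sound p ℓ⊨ rs₁ , Run⇒Rel r
  P-sound (p-seq2 p q) ℓ⊨ rs          = _ , P-sound p ℓ⊨ [] , P-sound q ℓ⊨ rs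
  P-sound p-*0         _ []           = ε
  P-sound (p-*1 {δ = δ} {δs} p) ℓ⊨ rs with Runs-++⁻ (δ ∷ δs) rs
  ... | _ , (_ , rs₁) , (_ , r ∷ []) = P-sound p ℓ⊨ rs₁ ◅ Run⇒Rel r

  data Unfolding (α : Prog) (n : ℕ) (w v : W) : Set where
    via : ∀ {X δs k} → H α X δs → (∀ {τ} → τ ∈ X → w ⊨ τ) → Runs δs k w v → k ≤ n →
          Unfolding α n w v

  H-complete : ∀ {w v} → Run α n w v → Unfolding α n w v
  H-complete (atomic r) = via h-atom (λ ()) (atomic r ∷ []) ≤-refl
  H-complete (tested t) = via h-test (λ { (here refl) → t }) [] z≤n
  H-complete (left r) with H-complete r
  ... | via h X⊨ rs k≤n = via (h-∪l h) X⊨ rs k≤n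
  H-complete (right r) with H-complete r
  ... | via h X⊨ rs k≤n = via (h-∪r h) X⊨ rs k≤n
  H-complete (seq {m = m} r s) with H-complete r
  ... | via h X⊨ rs@(_ ∷ _) k≤n = via (h-seq1 h) X⊨ (Runs-∷ʳ rs s) (+-monoˡ-≤ m k≤n)
  ... | via {X = X} h X⊨ [] _ with H-complete s
  ...   | via h′ Y⊨ rs k≤m =
          via (h-seq2 h h′) (either X⊨ Y⊨ ∘ ∈-++⁻ X) rs (≤-trans k≤m (m≤n+m m _))
  H-complete stop = via h-*0 (λ ()) [] z≤n
  H-complete (iterate {m = m} r s) with H-complete r
  ... | via h X⊨ rs@(_ ∷ _) k≤n = via (h-*1 h) X⊨ (Runs-∷ʳ rs s) (+-monoˡ-≤ m k≤n)
  -- An iteration without atomic steps can be skipped.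
  ... | via _ _ [] _ with H-complete s
  ...   | via h′ Y⊨ rs k≤m = via h′ Y⊨ rs (≤-trans k≤m (m≤n+m m _))

module Soundness (em : ExcludedMiddle 0ℓ) (M : Model) where
  open Model M
  open Semantics M
  open CountedRuns M

  ¬Box⇒Runs : ∀ δs {w} → ¬ w ⊨ Box δs φ → ∃₂ λ v n → Runs δs n w v × ¬ v ⊨ φ
  ¬Box⇒Runs []                 ¬φ = _ , 0 , [] , ¬φ
  ¬Box⇒Runs {φ} (δ ∷ δs) {w} ¬□ with em {∃ λ u → Rel δ w u × ¬ u ⊨ Box δs φ}
  ... | yes (u , r , ¬□′) =
        let v , n , rs , ¬φ = ¬Box⇒Runs δs ¬□′ ; k , r′ = Rel⇒Run δ r in v , k + n , r′ ∷ rs , ¬φ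
  ... | no ∄ = ⊥-elim (¬□ λ u r → em⇒dne em λ ¬□′ → ∄ (u , r , ¬□′))

  Holds≤ : ℕ → W → SF → Set
  Holds≤ n w (fm φ)      = w ⊨ φ
  Holds≤ n w (ld α αs φ) = ∃₂ λ v k → k ≤ n × Runs (α ∷ αs) k w v × ¬ v ⊨ φ

  Sat≤ : ℕ → W → Seq → Set
  Sat≤ n w Γ = ∀ {x} → x ∈ Γ → Holds≤ n w x

  Holds≤-mono : ∀ x {w} → n ≤ m → Holds≤ n w x → Holds≤ m w x
  Holds≤-mono (fm _)     _   h                       = h
  Holds≤-mono (ld _ _ _) n≤m (v , k , k≤n , rs , ¬φ) = v , k , ≤-trans k≤n n≤m , rs , ¬φ

  Holds≤⇒eval : ∀ x {w} → Holds≤ n w x → evalSF M w x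
  Holds≤⇒eval (fm _)     h                    = h
  Holds≤⇒eval (ld _ _ _) (_ , _ , _ , rs , ¬φ) = Runs-refute rs ¬φ

  eval⇒Holds≤ : ∀ x {w} → evalSF M w x → ∃ λ n → Holds≤ n w x
  eval⇒Holds≤ (fm _)      h  = 0 , h
  eval⇒Holds≤ (ld α αs φ) ¬□ =
    let v , n , rs , ¬φ = ¬Box⇒Runs (α ∷ αs) ¬□ in n , v , n , ≤-refl , rs , ¬φ

  Sat≤-mono : ∀ {Γ w} → n ≤ m → Sat≤ n w Γ → Sat≤ m w Γ
  Sat≤-mono n≤m sat {x} x∈ = Holds≤-mono x n≤m (sat x∈)

  sat⇒Sat≤ : ∀ Γ {w} → (∀ x → x ∈ Γ → evalSF M w x) → ∃ λ n → Sat≤ n w Γ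
  sat⇒Sat≤ []      _   = 0 , λ ()
  sat⇒Sat≤ (x ∷ Γ) sat =
    let n , x✓ = eval⇒Holds≤ x (sat x (here refl)) ; m , Γ✓ = sat⇒Sat≤ Γ (λ y → sat y ∘ there) in
    n ⊔ m , λ { (here refl) → Holds≤-mono x (m≤m⊔n n m) x✓
              ; (there y∈)  → Sat≤-mono (m≤n⊔m n m) Γ✓ y∈ }

  negLBox-holds : ∀ δs {w v} → Runs δs k w v → ¬ v ⊨ φ → k ≤ n → Holds≤ n w (negLBox δs φ)
  negLBox-holds []      []  ¬φ _   = ¬φ
  negLBox-holds (_ ∷ _) rs  ¬φ k≤n = _ , _ , k≤n , rs , ¬φ

  closed-unsat : ∀ {Γ w} → ClosedSeq Γ → ¬ Sat≤ n w Γ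
  closed-unsat (inj₁ ⊥∈)              sat = sat ⊥∈
  closed-unsat (inj₂ (_ , φ∈ , ¬φ∈)) sat = sat ¬φ∈ (sat φ∈)

  principal : ∀ {Γ Δ x w} → Princ Γ Δ x → Sat≤ n w Γ → Holds≤ n w x
  principal (Γ≈ , _) sat = sat (proj₂ (Γ≈ _) (here refl))

  context : ∀ {Γ Δ x w} → Princ Γ Δ x → Sat≤ n w Γ → Sat≤ n w Δ
  context (Γ≈ , _) sat = sat ∘ proj₂ (Γ≈ _) ∘ there

  data Successor (Γ : Seq) (n : ℕ) (cs : List Seq) : Set where
    successor : ∀ {c n′ w} → c ∈ cs → Sat≤ n′ w c → Advance Γ n c n′ ⊎ Free Γ → Successor Γ n cs

  local-successor : ∀ {Γ Δ x c cs S w} → c ∈ cs → Princ Γ Δ x → c ⊆ Δ ∪ S →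
                    (∀ {z} → S z → sfWeight z < sfWeight x) → (∀ {z} → S z → Holds≤ n w z) →
                    Sat≤ n w Γ → Successor Γ n cs
  local-successor c∈ pr c⊆ lighter holds sat =
    successor c∈ (either (context pr sat) holds ∘ c⊆)
      (inj₁ (replaced ≤-refl (Princ-replaces pr c⊆ lighter)))

  chosen-successor : ∀ {Γ Δ x I S cs w} → ChildrenOf Δ I S cs → Princ Γ Δ x → (i : I) →
                     (∀ {z} → S i z → sfWeight z < sfWeight x) → (∀ {z} → S i z → Holds≤ n w z) →
                     Sat≤ n w Γ → Successor Γ n cs
  chosen-successor (_ , children) pr i lighter holds =
    let _ , c∈ , c≈ = children i in local-successor c∈ pr (proj₁ (c≈ _)) lighter holds

  box-sound : ∀ {Γ Δ cs w} → NonAtomic α → Princ Γ Δ (fm ([ α ] φ)) →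
              ChildrenOf Δ (BoxIdx α) (λ i → X□ (proj₁ i) α φ) cs → Sat≤ n w Γ → Successor Γ n cs
  box-sound {α = α} {φ = φ} {n = n} {w = w} na pr children sat =
    chosen-successor children pr (trueTests , λ _ → proj₁ ∘ ∈-filter⁻ holds? {xs = Tests α})
      lighter holds sat
    where
      holds? : Decidable (w ⊨_)
      holds? τ = em
      trueTests : List Form
      trueTests = filter holds? (Tests α)
      lighter : ∀ {z} → X□ trueTests α φ z → sfWeight z < weight ([ α ] φ)
      lighter (inj₁ (τ , τ∈ , _ , refl)) =
        <-boxWeight na (≤-trans (weight<testWeight α τ∈) (m≤n+m _ _))
      lighter (inj₂ (δs , p , refl)) =
        <-boxWeight na (≤-trans (weight-Box-atomHeaded (P-atomHeaded p)) (m≤m+n _ _))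
      holds : ∀ {z} → X□ trueTests α φ z → Holds≤ n w z
      holds (inj₁ (τ , τ∈ , τ∉trueTests , refl)) τ✓ = τ∉trueTests (∈-filter⁺ holds? τ∈ τ✓)
      holds (inj₂ (δs , p , refl)) =
        Runs⇒Box δs λ rs →
          principal pr sat _ (P-sound p (proj₂ ∘ ∈-filter⁻ holds? {xs = Tests α}) rs)

  diamond-sound : ∀ {Γ Δ cs w} → NonAtomic α → Princ Γ Δ (fm (~ [ α ] φ)) →
                  ChildrenOf Δ (DiaIdx α) (X◇ α φ) cs → Sat≤ n w Γ → Successor Γ n cs
  diamond-sound {α = α} {φ = φ} {n = n} {w = w} na pr children sat
    with ¬Box⇒Runs {φ = φ} (α ∷ []) (principal pr sat)
  ... | _ , _ , r ∷ [] , ¬φ with H-complete r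
  ... | via {X} {δs} h X⊨ rs _ = chosen-successor children pr (X , δs , h) lighter holds sat
    where
      lighter : ∀ {z} → X◇ α φ (X , δs , h) z → sfWeight z < weight (~ [ α ] φ)
      lighter (inj₁ (τ , τ∈ , refl)) = m<n⇒m<1+n
        (<-boxWeight na (≤-trans (<⇒≤ (weight<testWeight α (H-tests h τ∈))) (m≤n+m _ _)))
      lighter (inj₂ refl) = s≤s
        (<-boxWeight na (≤-trans (weight-Box-atomHeaded (H-atomHeaded h)) (m≤m+n _ _)))
      holds : ∀ {z} → X◇ α φ (X , δs , h) z → Holds≤ n w z
      holds (inj₁ (τ , τ∈ , refl)) = X⊨ τ∈
      holds (inj₂ refl)             = Runs-refute rs ¬φ

  loaded-diamond-sound : ∀ {Γ Δ cs w} → NonAtomic α → Princ Γ Δ (ld α αs φ) →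
                         ChildrenOf Δ (DiaIdx α) (X◇L α αs φ) cs → Sat≤ n w Γ → Successor Γ n cs
  loaded-diamond-sound {α = α} {αs = αs} {φ = φ} {n = n} {w = w} na pr children sat
    with principal pr sat
  ... | _ , _ , k≤n , _∷_ {m = k₂} r rs₂ , ¬φ with H-complete r
  ... | via {X} {δs} h X⊨ rs₁ k₁≤ = chosen-successor children pr (X , δs , h) lighter holds sat
    where
      lighter : ∀ {z} → X◇L α αs φ (X , δs , h) z → sfWeight z < sfWeight (ld α αs φ)
      lighter (inj₁ (τ , τ∈ , refl)) = m<n⇒m<1+n (m<n⇒m<1+n
        (<-boxWeight na (≤-trans (<⇒≤ (weight<testWeight α (H-tests h τ∈))) (m≤n+m _ _))))
      lighter (inj₂ refl) = ≤-<-trans (sfWeight-negLBox (δs ++ αs)) (s≤s (s≤s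
        (<-boxWeight na (≤-trans (weight-Box-++-atomHeaded (H-atomHeaded h)) (m≤m+n _ _)))))
      holds : ∀ {z} → X◇L α αs φ (X , δs , h) z → Holds≤ n w z
      holds (inj₁ (τ , τ∈ , refl)) = X⊨ τ∈
      holds (inj₂ refl) =
        negLBox-holds (δs ++ αs) (Runs-++⁺ rs₁ rs₂) ¬φ (≤-trans (+-monoˡ-≤ k₂ k₁≤) k≤n)

  load-sound : ∀ {Γ Δ c w} → Free Δ → Princ Γ Δ (fm (~ Box (atom a ∷ αs) φ)) →
               c ≈ (ld (atom a) αs φ ∷ Δ) → Sat≤ n w Γ → Successor Γ n (c ∷ [])
  load-sound {c = c} {w = w} free pr c≈ sat =
    successor (here refl) (proj₂ (sat⇒Sat≤ c c✓)) (inj₂ (Princ-free pr free))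
    where
      c✓ : ∀ x → x ∈ c → evalSF M w x
      c✓ x x∈ with proj₁ (c≈ x) x∈
      ... | here refl = principal pr sat
      ... | there x∈Δ = Holds≤⇒eval x (context pr sat x∈Δ)

  modal-sound : ∀ {Γ Δ c w} → Princ Γ Δ (ld (atom a) αs φ) → c ≈P MChild Δ a αs φ →
                Sat≤ n w Γ → Successor Γ n (c ∷ [])
  modal-sound {a = a} {αs = αs} {φ = φ} {Δ = Δ} pr c≈ sat with principal pr sat
  ... | _ , _ , 1+k≤n , _∷_ {m = k} (atomic {v = u} r) rs , ¬φ =
    successor (here refl) (holds ∘ proj₁ (c≈ _)) (inj₁ (shortened 1+k≤n))
    where
      holds : ∀ {z} → MChild Δ a αs φ z → Holds≤ k u z
      holds (inj₁ (ψ , □ψ∈ , refl)) = context pr sat □ψ∈ u r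
      holds (inj₂ refl)              = negLBox-holds αs rs ¬φ ≤-refl

  step-sound : ∀ {Γ cs w} → Step Γ cs → Sat≤ n w Γ → Successor Γ n cs
  step-sound (r¬ pr c≈) sat =
    local-successor (here refl) pr (≈-++⇒⊆∪ (_ ∷ []) c≈)
      (λ { (here refl) → s≤s (n≤1+n _) }) (λ { (here refl) → em⇒dne em (principal pr sat) }) sat
  step-sound (r∧ pr c≈) sat =
    local-successor (here refl) pr (≈-++⇒⊆∪ (_ ∷ _ ∷ []) c≈)
      (λ { (here refl) → s≤s (m≤m+n _ _) ; (there (here refl)) → s≤s (m≤n+m _ _) })
      (λ { (here refl) → proj₁ (principal pr sat)
         ; (there (here refl)) → proj₂ (principal pr sat) })
      sat
  step-sound {w = w} (r¬∧ {φ = φ} pr c≈ d≈) sat with em {w ⊨ φ}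
  ... | yes φ✓ =
    local-successor (there (here refl)) pr (≈-++⇒⊆∪ (_ ∷ []) d≈)
      (λ { (here refl) → s≤s (s≤s (m≤n+m _ _)) })
      (λ { (here refl) ψ✓ → principal pr sat (φ✓ , ψ✓) })
      sat
  ... | no ¬φ =
    local-successor (here refl) pr (≈-++⇒⊆∪ (_ ∷ []) c≈)
      (λ { (here refl) → s≤s (s≤s (m≤m+n _ _)) }) (λ { (here refl) → ¬φ }) sat
  step-sound (r□ na pr children)  = box-sound na pr children
  step-sound (r◇ na pr children)  = diamond-sound na pr children
  step-sound (r◇L na pr children) = loaded-diamond-sound na pr children
  step-sound (rL+ free _ _ pr c≈) = load-sound free pr c≈
  step-sound (rL- _ pr c≈) sat =
    local-successor (here refl) pr (≈-++⇒⊆∪ (_ ∷ []) c≈)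
      (λ { (here refl) → ≤-refl })
      (λ { (here refl) → Holds≤⇒eval (ld _ _ _) (principal pr sat) })
      sat
  step-sound (rM _ pr c≈) = modal-sound pr c≈

  data SatisfiedRepeat (hist : List Seq) : Set where
    repeat : ∀ {Γ n w} → Sat≤ n w Γ → LoadedToCompanion Γ hist → SatisfiedRepeat hist

  data Escape (Γ : Seq) (n : ℕ) (hist : List Seq) : Set where
    escape : ∀ {Γ′ n′ w} → Sat≤ n′ w Γ′ → LoadedToCompanion Γ′ hist → Descent Γ n Γ′ n′ →
             Escape Γ n hist

  forget : ∀ {Γ hist} → Escape Γ n hist → SatisfiedRepeat hist
  forget (escape sat companion _) = repeat sat companion

  lift-escape : ∀ {Γ hist} → m < n → Escape Γ m hist → Escape Γ n hist
  lift-escape m<n (escape sat companion d) =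
    escape sat companion (shortened (≤-<-trans (descent-bound d) m<n))

  advance : ∀ {Γ c n₁} → Loaded Γ → Advance Γ n c n₁ ⊎ Free Γ → Advance Γ n c n₁
  advance _      (inj₁ adv)  = adv
  advance loaded (inj₂ free) = ⊥-elim (free loaded)

  -- A satisfied repeat of the parent Γ itself is only possible with a strictly smaller bound,
  -- so it is handed back to the well-founded induction at Γ.
  climb : ∀ {Γ c hist n₁} → Advance Γ n c n₁ ⊎ Free Γ → Escape c n₁ (Γ ∷ hist) →
          (∀ {m} → m < n → ∀ {w} → Sat≤ m w Γ → Escape Γ m hist) → Escape Γ n hist
  climb {n = n} progress (escape {n′ = m} sat (here Γ≈ loaded) d) restart =
    lift-escape m<n (restart m<n (sat ∘ proj₁ (Γ≈ _)))
    where
      m<n : m < n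
      m<n = advance-return (advance loaded progress) d (proj₁ (Γ≈ _))
  climb progress (escape sat (there _ loaded companion) d) _ =
    escape sat companion (advance-descent (advance loaded progress) d)

  mutual
    escapes : ∀ {Γ hist w} (t : Tab Γ) → LeavesClosed hist t → Sat≤ n w Γ → Escape Γ n hist
    escapes (leaf _) (leafC _ (inj₁ closed)) sat = ⊥-elim (closed-unsat closed sat)
    escapes (leaf _) (leafC _ (inj₂ (_ , companion))) sat = escape sat companion (replaced ≤-refl ε)
    escapes {n} {Γ} {hist} (node r ts) (nodeC lcs) = <-rec Claim by-bound n
      where
        Claim : ℕ → Set
        Claim n = ∀ {w} → Sat≤ n w Γ → Escape Γ n hist
        by-bound : ∀ n → (∀ {m} → m < n → Claim m) → Claim n
        by-bound n restart sat with step-sound r sat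
        ... | successor c∈ csat progress = climb progress (child-escapes ts lcs c∈ csat) restart

    child-escapes : ∀ {cs c hist w} (ts : Tabs cs) → LeavesClosedS hist ts → c ∈ cs →
                    Sat≤ n w c → Escape c n hist
    child-escapes (t ∷ _)  (lc ∷ _)   (here refl) sat = escapes t lc sat
    child-escapes (_ ∷ ts) (_ ∷ lcs) (there c∈)  sat = child-escapes ts lcs c∈ sat

  mutual
    node-repeat : ∀ {Γ Δ hist w} (t : Tab Γ) → LeavesClosed hist t → NodeOf t Δ → Sat≤ n w Δ →
                  SatisfiedRepeat hist
    node-repeat t lc here sat = forget (escapes t lc sat)
    node-repeat (node r ts) (nodeC lcs) (below Δ∈) sat with nodes-repeat ts lcs Δ∈ sat
    ... | repeat sat′ (here Γ≈ _) = forget (escapes (node r ts) (nodeC lcs) (sat′ ∘ proj₁ (Γ≈ _)))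
    ... | repeat sat′ (there _ _ companion) = repeat sat′ companion

    nodes-repeat : ∀ {cs Δ hist w} (ts : Tabs cs) → LeavesClosedS hist ts → NodesOf ts Δ →
                   Sat≤ n w Δ → SatisfiedRepeat hist
    nodes-repeat (t ∷ _)  (lc ∷ _)   (hd Δ∈) sat = node-repeat t lc Δ∈ sat
    nodes-repeat (_ ∷ ts) (_ ∷ lcs) (tl Δ∈) sat = nodes-repeat ts lcs Δ∈ sat

theorem5p1 : ExcludedMiddle 0ℓ →
    ∀ {Γ₀ : Seq} (T : Tab Γ₀) → IsClosedPDLTableau T →
    ∀ (Δ : Seq) → NodeOf T Δ → ¬ Satisfiable Δ
theorem5p1 em T (_ , leaves) Δ Δ∈T (M , w , sat) =
  no-companion (node-repeat T leaves Δ∈T (proj₂ (sat⇒Sat≤ Δ sat)))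
  where
    open Soundness em M
    no-companion : SatisfiedRepeat [] → ⊥
    no-companion (repeat _ ())
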